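{- Let $n\ge 1$, let $\pi$ be a permutation of $[n]=\{1,\dots,n\}$ and let $\rho:[n]\to\mathbb{N}$ be a pile assignment function. Then $\rho$ sorts $\pi$ on queues (i.e. the queue shuffle of $\pi$ with pile assignments $\rho$ yields the identity permutation) if and only if $$\rho(s+1)\ \ge\ \rho(s)+[\pi(s+1)<\pi(s)]\qquad\text{for all } s\in[n-1].$$
   Context: A deck of $n$ distinct cards labelled by $[n]$ is represented by a permutation $\pi$ of $[n]$ in the embedding convention: $\pi(s)$ is the position (counted from the top, starting at $1$) of label $s$ in the deck. The sorted deck is the identity permutation. In a pile shuffle, cards are dealt from the top of the deck onto piles, and then the piles are collected whole, one after another, to form the new deck; a pile assignment function $\rho:[n]\to\mathbb{N}$ sends label $s$ to the $\rho(s)$-th pile collected (piles with smaller index end up earlier in the new deck). A queue preserves the order in which cards were placed on it. Formally, the queue shuffle of $\pi$ with pile assignments $\rho$ is the unique permutation $\sigma$ of $[n]$ such that for all labels $s,t$: $\sigma(s)<\sigma(t)$ iff $(\rho(s),\pi(s))<(\rho(t),\pi(t))$ in lexicographic order. We say $\rho$ sorts $\pi$ on queues if this $\sigma$ is the identity. $[P]$ denotes the indicator of the proposition $P$ ($1$ if true, $0$ otherwise). -}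

module Defs where

open import Data.Nat using (ℕ; zero; suc; _+_; _<_; _≤_; _<ᵇ_)
open import Data.Bool using (Bool; true; false)
open import Data.Fin using (Fin; toℕ; fromℕ<)
open import Data.Fin.Permutation using (Permutation′; _⟨$⟩ʳ_; id)
open import Data.Product using (_×_)
open import Data.Sum using (_⊎_)
open import Relation.Binary.PropositionalEquality using (_≡_)
open import Function.Bundles using (_⇔_)

-- Labels and positions are 0-indexed: label s ∈ [n] is represented by Fin n
-- element s-1, and position p by Fin n element p-1.
-- A deck is π : Permutation′ n, with π ⟨$⟩ʳ s the position of label s.

PileAssignment : ℕ → Set
PileAssignment n = Fin n → ℕ

_<lex_ : ℕ × ℕ → ℕ × ℕ → Set
(a Data.Product., b) <lex (c Data.Product., d) = (a < c) ⊎ ((a ≡ c) × (b < d))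

IsQueueShuffle : {n : ℕ} → Permutation′ n → PileAssignment n → Permutation′ n → Set
IsQueueShuffle π ρ σ =
  ∀ s t → (toℕ (σ ⟨$⟩ʳ s) < toℕ (σ ⟨$⟩ʳ t))
        ⇔ ((ρ s Data.Product., toℕ (π ⟨$⟩ʳ s)) <lex (ρ t Data.Product., toℕ (π ⟨$⟩ʳ t)))

SortsOnQueues : {n : ℕ} → Permutation′ n → PileAssignment n → Set
SortsOnQueues π ρ = IsQueueShuffle π ρ id

[_] : Bool → ℕ
[ true ] = 1
[ false ] = 0

{-# OPTIONS --safe #-}
module Submission where

-- Sorting on queues means that the key s ↦ (ρ s, π s) is strictly increasing
-- for the lexicographic order, because the queue shuffle orders the labels by
-- this key.  As the lexicographic order is a strict partial order, the key is
-- strictly increasing as soon as it increases between consecutive labels, and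
-- (ρ s, π s) <lex (ρ (s+1), π (s+1)) says exactly that ρ must go up by at least
-- one when π descends from s to s+1.

open import Defs
open import Data.Nat using (ℕ; suc; _+_; _≤_; _<_; _<ᵇ_)
open import Data.Nat.Properties
  using (<⇒≤; <-isStrictPartialOrder; <ᵇ-reflects-<; <-asym; +-comm; +-identityʳ;
         ≤-reflexive; ≤∧≢⇒<; ≮⇒≥; m≤n⇒m<n∨m≡n; m<1+n⇒m<n∨m≡n; n<1+n)
open import Data.Bool using (true; false)
open import Data.Empty using (⊥-elim)
open import Data.Fin using (Fin; toℕ; fromℕ<) renaming (_<_ to _<ᶠ_)
open import Data.Fin.Properties using (toℕ-injective; toℕ<n; toℕ-fromℕ<; fromℕ<-toℕ; <⇒≢)
  renaming (<-cmp to <ᶠ-cmp)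
open import Data.Fin.Permutation using (Permutation′; _⟨$⟩ʳ_)
open import Data.Product using (_×_; _,_; proj₁)
open import Data.Product.Relation.Binary.Lex.Strict using (×-isStrictPartialOrder)
open import Data.Product.Relation.Binary.Pointwise.NonDependent using (Pointwise)
open import Data.Sum using (inj₁; inj₂; [_,_]′; map₂)
open import Function using (id; _∘_)
open import Function.Bundles using (_⇔_; mk⇔; Injection; module Equivalence)
open import Function.Properties.Inverse using (↔⇒↣)
import Function.Properties.Equivalence as ⇔
open import Relation.Binary.Core using (Rel; _Preserves_⟶_)
open import Relation.Binary.Definitions
  using (Trichotomous; Asymmetric; Transitive; tri<; tri≈; tri>)
open import Relation.Binary.Structures using (IsStrictPartialOrder)
open import Relation.Binary.PropositionalEquality using (_≡_; _≢_; refl; sym; subst₂)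
open import Relation.Nullary.Reflects using (ofʸ; ofⁿ)

<lex-isStrictPartialOrder : IsStrictPartialOrder (Pointwise _≡_ _≡_) _<lex_
<lex-isStrictPartialOrder =
  ×-isStrictPartialOrder <-isStrictPartialOrder <-isStrictPartialOrder

open IsStrictPartialOrder <lex-isStrictPartialOrder
  using () renaming (trans to <lex-trans; asym to <lex-asym)

<lex⇔+[<ᵇ]≤ : ∀ {r r′ p p′} → p ≢ p′ → (r , p) <lex (r′ , p′) ⇔ r + [ p′ <ᵇ p ] ≤ r′
<lex⇔+[<ᵇ]≤ {r} {r′} {p} {p′} p≢p′ with p′ <ᵇ p | <ᵇ-reflects-< p′ p
... | true  | ofʸ p′<p rewrite +-comm r 1 =
  mk⇔ [ id , (λ (_ , p<p′) → ⊥-elim (<-asym p<p′ p′<p)) ]′ inj₁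
... | false | ofⁿ p′≮p rewrite +-identityʳ r =
  mk⇔ [ <⇒≤ , ≤-reflexive ∘ proj₁ ]′ (map₂ (_, p<p′) ∘ m≤n⇒m<n∨m≡n)
  where
  p<p′ : p < p′
  p<p′ = ≤∧≢⇒< (≮⇒≥ p′≮p) p≢p′

module _ {a b ℓ₁ ℓ₂} {A : Set a} {B : Set b} {_<_ : Rel A ℓ₁} {_≺_ : Rel B ℓ₂}
         (<-cmp : Trichotomous _≡_ _<_) (≺-asym : Asymmetric _≺_) (f : A → B) where

  preserves⇒reflects : f Preserves _<_ ⟶ _≺_ → ∀ {x y} → f x ≺ f y → x < y
  preserves⇒reflects mono {x} {y} fx≺fy with <-cmp x y
  ... | tri< x<y _ _ = x<y
  ... | tri≈ _ refl _ = ⊥-elim (≺-asym fx≺fy fx≺fy)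
  ... | tri> _ _ y<x = ⊥-elim (≺-asym fx≺fy (mono y<x))

  embedding⇔preserves : (∀ x y → x < y ⇔ f x ≺ f y) ⇔ f Preserves _<_ ⟶ _≺_
  embedding⇔preserves =
    mk⇔ embedding⇒preserves (λ mono x y → mk⇔ mono (preserves⇒reflects mono))
    where
    embedding⇒preserves : (∀ x y → x < y ⇔ f x ≺ f y) → f Preserves _<_ ⟶ _≺_
    embedding⇒preserves emb {x} {y} = Equivalence.to (emb x y)

fromℕ<-adjacent : ∀ {i n} (h : suc i < n) → fromℕ< (<⇒≤ h) <ᶠ fromℕ< h
fromℕ<-adjacent {i} h = subst₂ _<_ (sym (toℕ-fromℕ< (<⇒≤ h))) (sym (toℕ-fromℕ< h)) (n<1+n i)

module _ {n b ℓ} {B : Set b} {_≺_ : Rel B ℓ} (≺-trans : Transitive _≺_) (f : Fin n → B) where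

  AdjacentlyIncreasing : Set ℓ
  AdjacentlyIncreasing = ∀ i (h : suc i < n) → f (fromℕ< (<⇒≤ h)) ≺ f (fromℕ< h)

  adjacentlyIncreasing⇒increasing : AdjacentlyIncreasing →
    ∀ {i j} (i<n : i < n) (j<n : j < n) → i < j → f (fromℕ< i<n) ≺ f (fromℕ< j<n)
  adjacentlyIncreasing⇒increasing adj {i} {suc j} i<n j+1<n i<j+1 with m<1+n⇒m<n∨m≡n i<j+1
  ... | inj₂ refl = adj i j+1<n  -- fromℕ< ignores its (irrelevant) proof argument
  ... | inj₁ i<j  =
    ≺-trans (adjacentlyIncreasing⇒increasing adj i<n (<⇒≤ j+1<n) i<j) (adj j j+1<n)

  preserves⇔adjacentlyIncreasing : f Preserves _<ᶠ_ ⟶ _≺_ ⇔ AdjacentlyIncreasing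
  preserves⇔adjacentlyIncreasing = mk⇔
    (λ mono i h → mono (fromℕ<-adjacent h))
    (λ adj {s} {t} s<t → subst₂ (λ s t → f s ≺ f t) (fromℕ<-toℕ s _) (fromℕ<-toℕ t _)
      (adjacentlyIncreasing⇒increasing adj (toℕ<n s) (toℕ<n t) s<t))

module _ {n} (π : Permutation′ n) (ρ : PileAssignment n) where

  queueKey : Fin n → ℕ × ℕ
  queueKey s = ρ s , toℕ (π ⟨$⟩ʳ s)

  queueKey-<lex⇔ : ∀ {s t} → s ≢ t →
    queueKey s <lex queueKey t ⇔ ρ s + [ toℕ (π ⟨$⟩ʳ t) <ᵇ toℕ (π ⟨$⟩ʳ s) ] ≤ ρ t
  queueKey-<lex⇔ s≢t = <lex⇔+[<ᵇ]≤ (s≢t ∘ Injection.injective (↔⇒↣ π) ∘ toℕ-injective)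

lemma1 : (n : ℕ) → 1 ≤ n → (π : Permutation′ n) → (ρ : PileAssignment n) →
    SortsOnQueues π ρ ⇔
      (∀ (i : ℕ) (h : suc i < n) →
        ρ (fromℕ< (<⇒≤ h)) + [ toℕ (π ⟨$⟩ʳ fromℕ< h) <ᵇ toℕ (π ⟨$⟩ʳ fromℕ< (<⇒≤ h)) ]
          ≤ ρ (fromℕ< h))
lemma1 n _ π ρ =
  ⇔.trans (embedding⇔preserves {_≺_ = _<lex_} <ᶠ-cmp <lex-asym key)
  (⇔.trans (preserves⇔adjacentlyIncreasing {_≺_ = _<lex_} <lex-trans key)
           (mk⇔ (λ adj i h → Equivalence.to (adjacentKeys-<lex⇔ i h) (adj i h))
                (λ cond i h → Equivalence.from (adjacentKeys-<lex⇔ i h) (cond i h))))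
  where
  key : Fin n → ℕ × ℕ
  key = queueKey π ρ

  adjacentKeys-<lex⇔ : ∀ i (h : suc i < n) →
    key (fromℕ< (<⇒≤ h)) <lex key (fromℕ< h) ⇔
      ρ (fromℕ< (<⇒≤ h)) + [ toℕ (π ⟨$⟩ʳ fromℕ< h) <ᵇ toℕ (π ⟨$⟩ʳ fromℕ< (<⇒≤ h)) ]
        ≤ ρ (fromℕ< h)
  adjacentKeys-<lex⇔ i h = queueKey-<lex⇔ π ρ (<⇒≢ (fromℕ<-adjacent h))
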